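{- If $d\ge1$ and $n\ge d+1$, then \[ \frac{n!}{(d+1)!}=\sum_{m=0}^{n-d-1}\ \sum_{\substack{i_1+i_2+\cdots+i_{m+1}=n-1-d-m\\ i_j\ge0}}\ \prod_{j=1}^{m+1}(d+j)^{i_j}\ \prod_{j=1}^{m}\Bigl(1+\sum_{\ell=1}^{j}i_\ell\Bigr). \]
   Context: Empty products equal $1$; the inner sum ranges over tuples $(i_1,\dots,i_{m+1})$ of nonnegative integers with the given sum. -}

module Defs where

open import Data.Nat using (ℕ; zero; suc; _+_; _*_; _^_; _∸_)
open import Data.List using (List; []; _∷_; map; concatMap; upTo)
open import Data.Nat.ListAction using (sum)
open import Data.Vec using (Vec; []; _∷_; lookup)
open import Data.Fin using (Fin; toℕ; fromℕ<)

sumTo : ℕ → (ℕ → ℕ) → ℕ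
sumTo zero f = 0
sumTo (suc n) f = sumTo n f + f n

prodTo : ℕ → (ℕ → ℕ) → ℕ
prodTo zero f = 1
prodTo (suc n) f = prodTo n f * f n

-- all tuples (i₁,…,i_k) ∈ ℕ^k with i₁ + ⋯ + i_k = s  (each listed exactly once)
compositions : (k s : ℕ) → List (Vec ℕ k)
compositions zero zero = [] ∷ []
compositions zero (suc s) = []
compositions (suc k) s =
  concatMap (λ i → map (i ∷_) (compositions k (s ∸ i))) (upTo (suc s))

-- 0-based access i_{j+1} = at v j (returns 0 out of range, never used there)
at : {k : ℕ} → Vec ℕ k → ℕ → ℕ
at [] j = 0
at (x ∷ v) zero = x
at (x ∷ v) (suc j) = at v j

term : (d m : ℕ) → Vec ℕ (suc m) → ℕ
term d m i =
  prodTo (suc m) (λ j → (d + suc j) ^ at i j)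
  * prodTo m (λ j → 1 + sumTo (suc j) (λ l → at i l))

rhs : (n d : ℕ) → ℕ
rhs n d = sumTo (suc (n ∸ d ∸ 1))
  (λ m → sum (map (term d m) (compositions (suc m) (n ∸ 1 ∸ d ∸ m))))

-- Generalise the summand to weight j p m i = Π_t (j + t)^{i_t} · Π_{t<m} (p + i_0 + ⋯ + i_t),
-- so that the theorem's summand is weight (d + 1) 1.  Summing over all m + s = k, where s is
-- the total of the tuple, gives the rising factorial (j + p)(j + p + 1)⋯(j + p + k - 1):
-- splitting on whether the first entry i_0 is zero (pull out p, shift j) or positive (pull out
-- j, lower i_0 and shift p) yields the recurrence T(j, p, k + 1) = p T(j + 1, p, k) + j T(j, p + 1, k)
-- of the rising factorial.  Finally n!/(d + 1)! is the rising factorial of d + 2 of length n - d - 1.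
module Submission where

open import Defs
open import Data.Nat using (ℕ; zero; suc; _+_; _*_; _^_; _∸_; _≤_; _<_; s≤s)
open import Data.Nat.Base using (_!)
open import Data.Nat.Properties
open import Data.Nat.ListAction using (sum)
open import Data.Nat.ListAction.Properties using (sum-++)
open import Data.Nat.Solver using (module +-*-Solver)
open import Data.List using (List; []; _∷_; map; concatMap; upTo; _++_; [_])
open import Data.List.Properties using (map-++; map-cong; map-∘; upTo-∷ʳ)
open import Data.Vec using (Vec; []; _∷_)
open import Data.Product using (_,_)
open import Function using (_∘_)
open import Relation.Binary.PropositionalEquality
  using (_≡_; refl; sym; trans; cong; cong₂; subst; module ≡-Reasoning)
open +-*-Solver using (solve; _:=_; _:*_; _:+_; con)

sumTo-cong : ∀ n {f g : ℕ → ℕ} → (∀ i → i < n → f i ≡ g i) → sumTo n f ≡ sumTo n g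
sumTo-cong zero     f≡g = refl
sumTo-cong (suc n) f≡g = cong₂ _+_ (sumTo-cong n (λ i i<n → f≡g i (m≤n⇒m≤1+n i<n))) (f≡g n ≤-refl)

prodTo-cong : ∀ n {f g : ℕ → ℕ} → (∀ i → f i ≡ g i) → prodTo n f ≡ prodTo n g
prodTo-cong zero    f≡g = refl
prodTo-cong (suc n) f≡g = cong₂ _*_ (prodTo-cong n f≡g) (f≡g n)

sumTo-head : ∀ n f → sumTo (suc n) f ≡ f 0 + sumTo n (f ∘ suc)
sumTo-head zero    f = +-comm 0 (f 0)
sumTo-head (suc n) f = trans (cong (_+ f (suc n)) (sumTo-head n f)) (+-assoc (f 0) _ _)

prodTo-head : ∀ n f → prodTo (suc n) f ≡ f 0 * prodTo n (f ∘ suc)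
prodTo-head zero    f = trans (*-identityˡ (f 0)) (sym (*-identityʳ (f 0)))
prodTo-head (suc n) f = trans (cong (_* f (suc n)) (prodTo-head n f)) (*-assoc (f 0) _ _)

sumTo-zero : ∀ n → sumTo n (λ _ → 0) ≡ 0
sumTo-zero zero    = refl
sumTo-zero (suc n) = trans (+-identityʳ _) (sumTo-zero n)

sumTo-+ : ∀ n f g → sumTo n (λ i → f i + g i) ≡ sumTo n f + sumTo n g
sumTo-+ zero    f g = refl
sumTo-+ (suc n) f g =
  trans (cong (_+ (f n + g n)) (sumTo-+ n f g))
        (solve 4 (λ F G x y → (F :+ G) :+ (x :+ y) := (F :+ x) :+ (G :+ y))
               refl (sumTo n f) (sumTo n g) (f n) (g n))

sumTo-*ˡ : ∀ n c f → sumTo n (λ i → c * f i) ≡ c * sumTo n f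
sumTo-*ˡ zero    c f = sym (*-zeroʳ c)
sumTo-*ˡ (suc n) c f = trans (cong (_+ c * f n) (sumTo-*ˡ n c f)) (sym (*-distribˡ-+ c _ _))

sum-map-upTo : ∀ (f : ℕ → ℕ) n → sum (map f (upTo n)) ≡ sumTo n f
sum-map-upTo f zero    = refl
sum-map-upTo f (suc n) = begin
  sum (map f (upTo (suc n)))       ≡⟨ cong (sum ∘ map f) (sym (upTo-∷ʳ n)) ⟩
  sum (map f (upTo n ++ [ n ]))    ≡⟨ cong sum (map-++ f (upTo n) [ n ]) ⟩
  sum (map f (upTo n) ++ [ f n ])  ≡⟨ sum-++ (map f (upTo n)) [ f n ] ⟩
  sum (map f (upTo n)) + (f n + 0) ≡⟨ cong₂ _+_ (sum-map-upTo f n) (+-identityʳ (f n)) ⟩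
  sumTo n f + f n                  ∎
  where open ≡-Reasoning

sum-map-concatMap : ∀ {A B : Set} (t : B → ℕ) (G : A → List B) xs →
  sum (map t (concatMap G xs)) ≡ sum (map (sum ∘ map t ∘ G) xs)
sum-map-concatMap t G []       = refl
sum-map-concatMap t G (x ∷ xs) =
  trans (cong sum (map-++ t (G x) (concatMap G xs)))
        (trans (sum-++ (map t (G x)) _) (cong (sum (map t (G x)) +_) (sum-map-concatMap t G xs)))

sum-map-*ˡ : ∀ {A : Set} c (t : A → ℕ) xs → sum (map (λ x → c * t x) xs) ≡ c * sum (map t xs)
sum-map-*ˡ c t []       = sym (*-zeroʳ c)
sum-map-*ˡ c t (x ∷ xs) = trans (cong (c * t x +_) (sum-map-*ˡ c t xs)) (sym (*-distribˡ-+ c _ _))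

antidiagonal : (ℕ → ℕ → ℕ) → ℕ → ℕ
antidiagonal f k = sumTo (suc k) (λ m → f m (k ∸ m))

antidiagonal-cong : ∀ k {f g : ℕ → ℕ → ℕ} → (∀ m s → f m s ≡ g m s) →
  antidiagonal f k ≡ antidiagonal g k
antidiagonal-cong k f≡g = sumTo-cong (suc k) (λ m _ → f≡g m (k ∸ m))

antidiagonal-head : ∀ f k → antidiagonal f (suc k) ≡ f 0 (suc k) + antidiagonal (f ∘ suc) k
antidiagonal-head f k = sumTo-head (suc k) _

antidiagonal-last : ∀ f k →
  antidiagonal f (suc k) ≡ antidiagonal (λ m s → f m (suc s)) k + f (suc k) 0
antidiagonal-last f k =
  cong₂ _+_ (sumTo-cong (suc k) (λ m m<1+k → cong (f m) (+-∸-assoc 1 (≤-pred m<1+k))))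
            (cong (f (suc k)) (n∸n≡0 k))

antidiagonal-linear : ∀ a b f g k →
  antidiagonal (λ m s → a * f m s + b * g m s) k ≡ a * antidiagonal f k + b * antidiagonal g k
antidiagonal-linear a b f g k =
  trans (sumTo-+ (suc k) _ _) (cong₂ _+_ (sumTo-*ˡ (suc k) a _) (sumTo-*ˡ (suc k) b _))

antidiagonal-recurrence : ∀ a b (f g h : ℕ → ℕ → ℕ) →
  (∀ s → f 0 (suc s) ≡ b * h 0 s) →
  (∀ m → f (suc m) 0 ≡ a * g m 0) →
  (∀ m s → f (suc m) (suc s) ≡ a * g m (suc s) + b * h (suc m) s) →
  ∀ k → antidiagonal f (suc k) ≡ a * antidiagonal g k + b * antidiagonal h k
antidiagonal-recurrence a b f g h f-zero-suc f-suc-zero f-suc-suc zero =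
  trans (cong₂ _+_ (cong (0 +_) (f-zero-suc 0)) (f-suc-zero 0))
        (solve 4 (λ a b G H → con 0 :+ b :* H :+ a :* G := a :* (con 0 :+ G) :+ b :* (con 0 :+ H))
               refl a b (g 0 0) (h 0 0))
antidiagonal-recurrence a b f g h f-zero-suc f-suc-zero f-suc-suc (suc k) = begin
  antidiagonal f (suc (suc k))
    ≡⟨ antidiagonal-head f (suc k) ⟩
  f 0 (suc (suc k)) + antidiagonal (f ∘ suc) (suc k)
    ≡⟨ cong₂ _+_ (f-zero-suc (suc k)) (antidiagonal-last (f ∘ suc) k) ⟩
  b * h 0 (suc k) + (antidiagonal (λ m s → f (suc m) (suc s)) k + f (suc (suc k)) 0)
    ≡⟨ cong (λ z → b * h 0 (suc k) + z)
            (cong₂ _+_ (trans (antidiagonal-cong k f-suc-suc)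
                              (antidiagonal-linear a b (λ m s → g m (suc s)) (h ∘ suc) k))
                       (f-suc-zero (suc k))) ⟩
  b * h 0 (suc k) + ((a * G + b * H) + a * g (suc k) 0)
    ≡⟨ solve 6 (λ a b h₀ G g₀ H → b :* h₀ :+ ((a :* G :+ b :* H) :+ a :* g₀)
                                := a :* (G :+ g₀) :+ b :* (h₀ :+ H))
             refl a b (h 0 (suc k)) G (g (suc k) 0) H ⟩
  a * (G + g (suc k) 0) + b * (h 0 (suc k) + H)
    ≡⟨ sym (cong₂ (λ x y → a * x + b * y) (antidiagonal-last g k) (antidiagonal-head h k)) ⟩
  a * antidiagonal g (suc k) + b * antidiagonal h (suc k)
    ∎
  where
  open ≡-Reasoning
  G = antidiagonal (λ m s → g m (suc s)) k
  H = antidiagonal (h ∘ suc) k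

sum-compositions-byHead : ∀ k (t : Vec ℕ (suc k) → ℕ) s →
  sum (map t (compositions (suc k) s))
    ≡ sumTo (suc s) (λ i → sum (map (t ∘ (i ∷_)) (compositions k (s ∸ i))))
sum-compositions-byHead k t s = begin
  sum (map t (compositions (suc k) s))
    ≡⟨ sum-map-concatMap t (λ i → map (i ∷_) (compositions k (s ∸ i))) (upTo (suc s)) ⟩
  sum (map (λ i → sum (map t (map (i ∷_) (compositions k (s ∸ i))))) (upTo (suc s)))
    ≡⟨ sum-map-upTo _ (suc s) ⟩
  sumTo (suc s) (λ i → sum (map t (map (i ∷_) (compositions k (s ∸ i)))))
    ≡⟨ sumTo-cong (suc s) (λ i _ → cong sum (sym (map-∘ (compositions k (s ∸ i))))) ⟩
  sumTo (suc s) (λ i → sum (map (t ∘ (i ∷_)) (compositions k (s ∸ i))))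
    ∎
  where open ≡-Reasoning

compositions-0-∸-< : ∀ {s i} → i < s → compositions 0 (s ∸ i) ≡ []
compositions-0-∸-< {suc s} {zero}  _         = refl
compositions-0-∸-< {suc s} {suc i} (s≤s i<s) = compositions-0-∸-< i<s

compositions-0-∸-self : ∀ s → compositions 0 (s ∸ s) ≡ [] ∷ []
compositions-0-∸-self s = cong (compositions 0) (n∸n≡0 s)

sum-compositions-1 : ∀ (t : Vec ℕ 1 → ℕ) s → sum (map t (compositions 1 s)) ≡ t (s ∷ [])
sum-compositions-1 t s = begin
  sum (map t (compositions 1 s))     ≡⟨ sum-compositions-byHead 0 t s ⟩
  sumTo s summand + summand s        ≡⟨ cong₂ _+_ earlier-vanish
                                                  (cong (sum ∘ map (t ∘ (s ∷_))) (compositions-0-∸-self s)) ⟩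
  0 + (t (s ∷ []) + 0)               ≡⟨ +-identityʳ _ ⟩
  t (s ∷ [])                         ∎
  where
  open ≡-Reasoning
  summand : ℕ → ℕ
  summand i = sum (map (t ∘ (i ∷_)) (compositions 0 (s ∸ i)))
  earlier-vanish : sumTo s summand ≡ 0
  earlier-vanish = trans (sumTo-cong s (λ i i<s →
                                 cong (sum ∘ map (t ∘ (i ∷_))) (compositions-0-∸-< i<s)))
                         (sumTo-zero s)

weight : (j p m : ℕ) → Vec ℕ (suc m) → ℕ
weight j p m i = prodTo (suc m) (λ t → (j + t) ^ at i t) * prodTo m (λ t → p + sumTo (suc t) (at i))

weight-∷ : ∀ j p m x (v : Vec ℕ (suc m)) →
  weight j p (suc m) (x ∷ v) ≡ j ^ x * (p + x) * weight (suc j) (p + x) m v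
weight-∷ j p m x v = begin
  weight j p (suc m) (x ∷ v)
    ≡⟨ cong₂ _*_ (prodTo-head (suc m) _) (prodTo-head m _) ⟩
  ((j + 0) ^ x * prodTo (suc m) (λ t → (j + suc t) ^ at v t))
    * ((p + x) * prodTo m (λ t → p + sumTo (suc (suc t)) (at (x ∷ v))))
    ≡⟨ cong₂ _*_ (cong₂ _*_ (cong (_^ x) (+-identityʳ j))
                            (prodTo-cong (suc m) (λ t → cong (_^ at v t) (+-suc j t))))
                 (cong ((p + x) *_) (prodTo-cong m (λ t →
                   trans (cong (p +_) (sumTo-head (suc t) (at (x ∷ v)))) (sym (+-assoc p x _))))) ⟩
  (j ^ x * powers) * ((p + x) * partialSums)
    ≡⟨ solve 4 (λ a P c Q → (a :* P) :* (c :* Q) := (a :* c) :* (P :* Q))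
               refl (j ^ x) powers (p + x) partialSums ⟩
  j ^ x * (p + x) * weight (suc j) (p + x) m v
    ∎
  where
  open ≡-Reasoning
  powers      = prodTo (suc m) (λ t → (suc j + t) ^ at v t)
  partialSums = prodTo m (λ t → (p + x) + sumTo (suc t) (at v))

weightSum : (j p m s : ℕ) → ℕ
weightSum j p m s = sum (map (weight j p m) (compositions (suc m) s))

weightSum-zero : ∀ j p s → weightSum j p 0 s ≡ j ^ s
weightSum-zero j p s = begin
  weightSum j p 0 s     ≡⟨ sum-compositions-1 (weight j p 0) s ⟩
  1 * (j + 0) ^ s * 1   ≡⟨ trans (*-identityʳ _) (*-identityˡ _) ⟩
  (j + 0) ^ s           ≡⟨ cong (_^ s) (+-identityʳ j) ⟩
  j ^ s                 ∎
  where open ≡-Reasoning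

weightSum-suc : ∀ j p m s → weightSum j p (suc m) s ≡
  sumTo (suc s) (λ i → j ^ i * (p + i) * weightSum (suc j) (p + i) m (s ∸ i))
weightSum-suc j p m s =
  trans (sum-compositions-byHead (suc m) (weight j p (suc m)) s)
        (sumTo-cong (suc s) (λ i _ →
          trans (cong sum (map-cong (weight-∷ j p m i) (compositions (suc m) (s ∸ i))))
                (sum-map-*ˡ (j ^ i * (p + i)) (weight (suc j) (p + i) m) (compositions (suc m) (s ∸ i)))))

weightSum-zero-suc : ∀ j p s → weightSum j p 0 (suc s) ≡ j * weightSum j (suc p) 0 s
weightSum-zero-suc j p s = trans (weightSum-zero j p (suc s)) (cong (j *_) (sym (weightSum-zero j (suc p) s)))

weightSum-suc-summand₀ : ∀ j p m s →
  1 * (p + 0) * weightSum (suc j) (p + 0) m s ≡ p * weightSum (suc j) p m s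
weightSum-suc-summand₀ j p m s = trans (cong (λ q → 1 * q * weightSum (suc j) q m s) (+-identityʳ p))
                              (cong (_* weightSum (suc j) p m s) (*-identityˡ p))

weightSum-suc-zero : ∀ j p m → weightSum j p (suc m) 0 ≡ p * weightSum (suc j) p m 0
weightSum-suc-zero j p m = trans (weightSum-suc j p m 0) (weightSum-suc-summand₀ j p m 0)

weightSum-suc-suc : ∀ j p m s → weightSum j p (suc m) (suc s)
  ≡ p * weightSum (suc j) p m (suc s) + j * weightSum j (suc p) (suc m) s
weightSum-suc-suc j p m s = begin
  weightSum j p (suc m) (suc s)
    ≡⟨ weightSum-suc j p m (suc s) ⟩
  sumTo (suc (suc s)) byHead
    ≡⟨ sumTo-head (suc s) byHead ⟩
  byHead 0 + sumTo (suc s) (byHead ∘ suc)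
    ≡⟨ cong₂ _+_ (weightSum-suc-summand₀ j p m (suc s))
                 (trans (sumTo-cong (suc s) (λ i _ → byHead-suc i)) (sumTo-*ˡ (suc s) j _)) ⟩
  p * weightSum (suc j) p m (suc s)
    + j * sumTo (suc s) (λ i → j ^ i * (suc p + i) * weightSum (suc j) (suc p + i) m (s ∸ i))
    ≡⟨ cong (λ z → p * weightSum (suc j) p m (suc s) + j * z) (sym (weightSum-suc j (suc p) m s)) ⟩
  p * weightSum (suc j) p m (suc s) + j * weightSum j (suc p) (suc m) s
    ∎
  where
  open ≡-Reasoning
  byHead : ℕ → ℕ
  byHead i = j ^ i * (p + i) * weightSum (suc j) (p + i) m (suc s ∸ i)
  byHead-suc : ∀ i →
    byHead (suc i) ≡ j * (j ^ i * (suc p + i) * weightSum (suc j) (suc p + i) m (s ∸ i))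
  byHead-suc i = trans (cong (λ q → j ^ suc i * q * weightSum (suc j) q m (s ∸ i)) (+-suc p i))
    (solve 4 (λ x y q z → (x :* y) :* q :* z := x :* (y :* q :* z)) refl
           j (j ^ i) (suc (p + i)) (weightSum (suc j) (suc (p + i)) m (s ∸ i)))

rising : ℕ → ℕ → ℕ
rising a zero    = 1
rising a (suc k) = a * rising (suc a) k

antidiagonal-weightSum : ∀ k j p → antidiagonal (weightSum j p) k ≡ rising (j + p) k
antidiagonal-weightSum zero    j p = weightSum-zero j p 0
antidiagonal-weightSum (suc k) j p = begin
  antidiagonal (weightSum j p) (suc k)
    ≡⟨ antidiagonal-recurrence p j (weightSum j p) (weightSum (suc j) p) (weightSum j (suc p))
         (weightSum-zero-suc j p) (weightSum-suc-zero j p) (weightSum-suc-suc j p) k ⟩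
  p * antidiagonal (weightSum (suc j) p) k + j * antidiagonal (weightSum j (suc p)) k
    ≡⟨ cong₂ (λ x y → p * x + j * y)
             (antidiagonal-weightSum k (suc j) p) (antidiagonal-weightSum k j (suc p)) ⟩
  p * rising (suc j + p) k + j * rising (j + suc p) k
    ≡⟨ cong (λ z → p * rising (suc (j + p)) k + j * rising z k) (+-suc j p) ⟩
  p * rising (suc (j + p)) k + j * rising (suc (j + p)) k
    ≡⟨ sym (*-distribʳ-+ _ p j) ⟩
  (p + j) * rising (suc (j + p)) k
    ≡⟨ cong (_* rising (suc (j + p)) k) (+-comm p j) ⟩
  rising (j + p) (suc k)
    ∎
  where open ≡-Reasoning

factorial-rising : ∀ a k → (a + k) ! ≡ a ! * rising (suc a) k
factorial-rising a zero    = trans (cong _! (+-identityʳ a)) (sym (*-identityʳ _))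
factorial-rising a (suc k) = begin
  (a + suc k) !                         ≡⟨ cong _! (+-suc a k) ⟩
  (suc a + k) !                         ≡⟨ factorial-rising (suc a) k ⟩
  (suc a * a !) * rising (suc (suc a)) k ≡⟨ solve 3 (λ x y z → (x :* y) :* z := y :* (x :* z))
                                                  refl (suc a) (a !) (rising (suc (suc a)) k) ⟩
  a ! * rising (suc a) (suc k)          ∎
  where open ≡-Reasoning

term-weight : ∀ d m (i : Vec ℕ (suc m)) → term d m i ≡ weight (suc d) 1 m i
term-weight d m i = cong (_* prodTo m (λ t → 1 + sumTo (suc t) (at i)))
                         (prodTo-cong (suc m) (λ t → cong (_^ at i t) (+-suc d t)))

rhs-antidiagonal : ∀ d k → rhs (suc (d + k)) d ≡ antidiagonal (weightSum (suc d) 1) k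
rhs-antidiagonal d k = begin
  rhs (suc (d + k)) d
    ≡⟨ cong₂ (λ x y → sumTo (suc x) (λ m → sum (map (term d m) (compositions (suc m) (y ∸ m)))))
             (cong (_∸ 1) (trans (cong (_∸ d) (sym (+-suc d k))) (m+n∸m≡n d (suc k))))
             (m+n∸m≡n d k) ⟩
  sumTo (suc k) (λ m → sum (map (term d m) (compositions (suc m) (k ∸ m))))
    ≡⟨ sumTo-cong (suc k) (λ m _ →
         cong sum (map-cong (term-weight d m) (compositions (suc m) (k ∸ m)))) ⟩
  antidiagonal (weightSum (suc d) 1) k
    ∎
  where open ≡-Reasoning

corollary2p8 : (d n : ℕ) → 1 ≤ d → d + 1 ≤ n →
    n ! ≡ (suc d) ! * rhs n d
corollary2p8 d n _ d+1≤n with m≤n⇒∃[o]m+o≡n (subst (_≤ n) (+-comm d 1) d+1≤n)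
... | k , refl = begin
  (suc d + k) !
    ≡⟨ factorial-rising (suc d) k ⟩
  suc d ! * rising (suc (suc d)) k
    ≡⟨ cong (λ a → suc d ! * rising a k) (+-comm 1 (suc d)) ⟩
  suc d ! * rising (suc d + 1) k
    ≡⟨ cong (suc d ! *_) (sym (antidiagonal-weightSum k (suc d) 1)) ⟩
  suc d ! * antidiagonal (weightSum (suc d) 1) k
    ≡⟨ cong (suc d ! *_) (sym (rhs-antidiagonal d k)) ⟩
  suc d ! * rhs (suc d + k) d
    ∎
  where open ≡-Reasoning
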